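{- Let $b\geq 1$ and $m\geq 0$ be integers, let $f(a,b,m)=(2a+1)2^{b-1}-\frac{1}{2}\left(\frac{2a+1}{2m+1}+1\right)$, and let $S_{b,m}=\{a\in\mathbb{N} : \mathcal{SG}((2a+1)2^b)=f(a,b,m)\}$, where $\mathcal{SG}$ is the nim-value in \textsc{saliquant}. Then the (upper asymptotic) density of $S_{b,m}$ is at most $\frac{1}{2m+1}$, i.e. $\limsup_{N\to\infty}\frac{|S_{b,m}\cap\{1,\dots,N\}|}{N}\leq\frac{1}{2m+1}$.
   Context: \textsc{saliquant} is the normal-play impartial game whose positions are the positive integers, where the options of a position $n\geq 1$ are $\{n-k : 1\leq k\leq n,\ k\nmid n\}$. The nim-value is defined recursively by $\mathcal{SG}(n)=\operatorname{mex}\{\mathcal{SG}(x) : x \text{ an option of } n\}$, where $\operatorname{mex}(A)$ is the least nonnegative integer not in $A$. -}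

module Defs where

open import Data.Nat using (ℕ; zero; suc; _+_; _*_; _∸_; _^_; _≤_; _<_)
open import Data.Nat.Properties using (<⇒≤; ≤-refl; _≟_)
open import Data.Nat.Divisibility using (_∣_; _∣?_)
open import Data.Nat.Induction using (<-rec)
open import Data.List using (List; []; _∷_; length; filter; upTo)
open import Data.List.Membership.DecPropositional _≟_ using (_∈?_)
open import Relation.Nullary using (yes; no)

-- mex of a finite list: the least natural number not in the list.
-- The answer is always ≤ length xs, so searching the candidates
-- 0, 1, ..., length xs suffices.
mexFrom : ℕ → ℕ → List ℕ → ℕ
mexFrom zero      c xs = c
mexFrom (suc fuel) c xs with c ∈? xs
... | yes _ = mexFrom fuel (suc c) xs
... | no  _ = c

mex : List ℕ → ℕ
mex xs = mexFrom (length xs) 0 xs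

-- Given n and (recursively computed) values r j for j < n, list
-- r j for those j = n ∸ k with 1 ≤ k ≤ n and k ∤ n, i.e. the nim-values
-- of the saliquant options of n.  (i ranges over 0 .. n-1 as the index j.)
optionValues : (n i : ℕ) → i ≤ n → (∀ {j} → j < n → ℕ) → List ℕ
optionValues n zero    _ r = []
optionValues n (suc i) p r with (n ∸ i) ∣? n
... | yes _ = optionValues n i (<⇒≤ p) r
... | no  _ = r p ∷ optionValues n i (<⇒≤ p) r

-- Nim-value of saliquant:  SG n = mex { SG (n - k) : 1 ≤ k ≤ n, k ∤ n }.
-- (Position 0 is not a game position; the recursion gives SG 0 = 0.)
SG : ℕ → ℕ
SG = <-rec (λ _ → ℕ) (λ n r → mex (optionValues n n ≤-refl r))

-- a ∈ S_{b,m}  ⇔  SG((2a+1)2^b) = f(a,b,m) where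
-- f(a,b,m) = (2a+1)2^{b-1} - ((2a+1)/(2m+1) + 1)/2.
-- Multiplying by 2(2m+1) (exact, f rational) this is the equation
--   2(2m+1)·SG((2a+1)2^b) + (2a+1) + (2m+1) = (2a+1)(2m+1)2^b   in ℕ.
inS : (b m a : ℕ) → Set
inS b m a =
  2 * (2 * m + 1) * SG ((2 * a + 1) * 2 ^ b) + (2 * a + 1) + (2 * m + 1)
    ≡ (2 * a + 1) * (2 * m + 1) * 2 ^ b
  where open import Relation.Binary.PropositionalEquality using (_≡_)

inS? : (b m a : ℕ) → Relation.Nullary.Dec (inS b m a)
inS? b m a = _ ≟ _

countS : (b m N : ℕ) → ℕ
countS b m N = length (filter (inS? b m) (Data.List.map suc (upTo N)))

-- Every a ∈ S_{b,m} has 2m+1 ∣ 2a+1: clearing denominators, the defining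
-- equation reads (2·SG + 1)(2m+1) + (2a+1) = (2a+1)2^b(2m+1).  Two such a are
-- at least 2m+1 apart, because 2m+1 is odd and divides twice their distance.
-- Hence at most (N + 2m)/(2m+1) of the numbers 1, …, N lie in S_{b,m}.
module Submission where

open import Defs
open import Data.Nat using (ℕ; zero; suc; _+_; _*_; _∸_; _^_; _≤_; _<_; z≤n)
open import Data.Nat.Properties
open import Data.Nat.Divisibility using (_∣_; divides; ∣⇒≤; ∣m+n∣m⇒∣n; ∣n⇒∣m*n; m∣m*n)
open import Data.Nat.Tactic.RingSolver using (solve-∀)
open import Data.List using ([_]; length; filter; upTo; map; _++_)
open import Data.List.Properties using (upTo-∷ʳ; map-++; filter-++; length-++; filter-accept; filter-reject)
open import Data.Product using (_,_; ∃-syntax)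
open import Relation.Nullary using (yes; no; ¬_)
open import Relation.Unary using (Pred; Decidable)
open import Relation.Binary.PropositionalEquality using (_≡_; sym; trans; cong; subst; module ≡-Reasoning)

count : ∀ {p} {P : Pred ℕ p} → Decidable P → ℕ → ℕ
count P? N = length (filter P? (map suc (upTo N)))

module _ {p} {P : Pred ℕ p} (P? : Decidable P) where

  count-suc : ∀ N → count P? (suc N) ≡ count P? N + length (filter P? [ suc N ])
  count-suc N = begin
      length (filter P? (map suc (upTo (suc N))))
    ≡⟨ cong (λ l → length (filter P? (map suc l))) (sym (upTo-∷ʳ N)) ⟩
      length (filter P? (map suc (upTo N ++ [ N ])))
    ≡⟨ cong (λ l → length (filter P? l)) (map-++ suc (upTo N) [ N ]) ⟩
      length (filter P? (map suc (upTo N) ++ [ suc N ]))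
    ≡⟨ cong length (filter-++ P? (map suc (upTo N)) [ suc N ]) ⟩
      length (filter P? (map suc (upTo N)) ++ filter P? [ suc N ])
    ≡⟨ length-++ (filter P? (map suc (upTo N))) ⟩
      count P? N + length (filter P? [ suc N ])
    ∎
    where open ≡-Reasoning

  count-accept : ∀ {N} → P (suc N) → count P? (suc N) ≡ suc (count P? N)
  count-accept {N} p = begin
      count P? (suc N)                              ≡⟨ count-suc N ⟩
      count P? N + length (filter P? [ suc N ])     ≡⟨ cong (λ l → count P? N + length l) (filter-accept P? p) ⟩
      count P? N + 1                                ≡⟨ +-comm (count P? N) 1 ⟩
      suc (count P? N)                              ∎
    where open ≡-Reasoning

  count-reject : ∀ {N} → ¬ P (suc N) → count P? (suc N) ≡ count P? N
  count-reject {N} ¬p = begin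
      count P? (suc N)                              ≡⟨ count-suc N ⟩
      count P? N + length (filter P? [ suc N ])     ≡⟨ cong (λ l → count P? N + length l) (filter-reject P? ¬p) ⟩
      count P? N + 0                                ≡⟨ +-identityʳ (count P? N) ⟩
      count P? N                                    ∎
    where open ≡-Reasoning

  module Separated (e : ℕ) (separated : ∀ {x y} → P x → P y → x < y → x + suc e ≤ y) where

    count-before-member : ∀ N {y} → P y → N < y → suc e * suc (count P? N) ≤ y + e
    count-before-member zero {y} _ 0<y = begin
      suc e * 1   ≡⟨ *-identityʳ (suc e) ⟩
      1 + e       ≤⟨ +-monoˡ-≤ e 0<y ⟩
      y + e       ∎
      where open ≤-Reasoning
    count-before-member (suc N) {y} py N<y with P? (suc N)
    ... | no ¬p rewrite count-reject ¬p = count-before-member N py (<-trans (n<1+n N) N<y)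
    ... | yes p rewrite count-accept p = begin
      suc e * suc (suc c)        ≡⟨ *-suc (suc e) (suc c) ⟩
      suc e + suc e * suc c      ≤⟨ +-monoʳ-≤ (suc e) (count-before-member N p (n<1+n N)) ⟩
      suc e + (suc N + e)        ≡⟨ regroup (suc e) (suc N) e ⟩
      suc N + suc e + e          ≤⟨ +-monoˡ-≤ e (separated p py N<y) ⟩
      y + e                      ∎
      where
      open ≤-Reasoning
      c = count P? N
      regroup : ∀ d n e → d + (n + e) ≡ n + d + e
      regroup = solve-∀

    count-separated : ∀ N → suc e * count P? N ≤ N + e
    count-separated zero = ≤-trans (≤-reflexive (*-zeroʳ (suc e))) z≤n
    count-separated (suc N) with P? (suc N)
    ... | yes p rewrite count-accept p = count-before-member N p (n<1+n N)
    ... | no ¬p rewrite count-reject ¬p = ≤-trans (count-separated N) (+-monoˡ-≤ e (n≤1+n N))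

odd-∣-double⇒∣ : ∀ m k → 2 * m + 1 ∣ 2 * k → 2 * m + 1 ∣ k
odd-∣-double⇒∣ m k d∣2k =
  ∣m+n∣m⇒∣n (subst (2 * m + 1 ∣_) (split m k) (∣n⇒∣m*n (m + 1) d∣2k)) (m∣m*n k)
  where
  split : ∀ m k → (m + 1) * (2 * k) ≡ (2 * m + 1) * k + k
  split = solve-∀

odd-multiples-separated : ∀ m {x y} → 2 * m + 1 ∣ 2 * x + 1 → 2 * m + 1 ∣ 2 * y + 1 →
  x < y → x + (2 * m + 1) ≤ y
odd-multiples-separated m {x} {y} d∣x d∣y x<y =
  subst (x + (2 * m + 1) ≤_) x+distance≡y (+-monoʳ-≤ x (d≤distance (m<n⇒0<n∸m x<y)))
  where
  distance = y ∸ x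
  x+distance≡y : x + distance ≡ y
  x+distance≡y = m+[n∸m]≡n (<⇒≤ x<y)
  shift : ∀ x k → 2 * (x + k) + 1 ≡ (2 * x + 1) + 2 * k
  shift = solve-∀
  d∣2·distance : 2 * m + 1 ∣ 2 * distance
  d∣2·distance = ∣m+n∣m⇒∣n
    (subst (2 * m + 1 ∣_) (trans (cong (λ z → 2 * z + 1) (sym x+distance≡y)) (shift x distance)) d∣y)
    d∣x
  d≤distance : 0 < distance → 2 * m + 1 ≤ distance
  d≤distance 0<distance with distance | odd-∣-double⇒∣ m distance d∣2·distance
  ... | suc _ | d∣distance = ∣⇒≤ d∣distance

inS⇒∣ : ∀ b m a → inS b m a → 2 * m + 1 ∣ 2 * a + 1
inS⇒∣ b m a eq = ∣m+n∣m⇒∣n (divides (A * 2 ^ b) rearranged) (m∣m*n (2 * S + 1))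
  where
  S = SG ((2 * a + 1) * 2 ^ b)
  A = 2 * a + 1
  d = 2 * m + 1
  expand : ∀ S A d → d * (2 * S + 1) + A ≡ 2 * d * S + A + d
  expand = solve-∀
  reassociate : ∀ A d P → A * d * P ≡ A * P * d
  reassociate = solve-∀
  rearranged : d * (2 * S + 1) + A ≡ A * 2 ^ b * d
  rearranged = trans (expand S A d) (trans eq (reassociate A d (2 ^ b)))

countS-bound : ∀ b m N → (2 * m + 1) * countS b m N ≤ N + 2 * m
countS-bound b m N = subst (λ d → d * countS b m N ≤ N + 2 * m) (+-comm 1 (2 * m))
  (Separated.count-separated (inS? b m) (2 * m) separated N)
  where
  separated : ∀ {x y} → inS b m x → inS b m y → x < y → x + suc (2 * m) ≤ y
  separated {x} {y} x∈S y∈S x<y = subst (λ d → x + d ≤ y) (+-comm (2 * m) 1)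
    (odd-multiples-separated m (inS⇒∣ b m x x∈S) (inS⇒∣ b m y y∈S) x<y)

mainTheorem16 : (b m : ℕ) → 1 ≤ b → (k : ℕ) →
    ∃[ N₀ ] ((N : ℕ) → N₀ ≤ N →
      (2 * m + 1) * suc k * countS b m N ≤ suc k * N + (2 * m + 1) * N)
mainTheorem16 b m _ k = suc k , bound
  where
  bound : ∀ N → suc k ≤ N → (2 * m + 1) * suc k * countS b m N ≤ suc k * N + (2 * m + 1) * N
  bound N k<N = begin
    (2 * m + 1) * suc k * c      ≡⟨ reassociate (2 * m + 1) (suc k) c ⟩
    suc k * ((2 * m + 1) * c)    ≤⟨ *-monoʳ-≤ (suc k) (countS-bound b m N) ⟩
    suc k * (N + 2 * m)          ≡⟨ *-distribˡ-+ (suc k) N (2 * m) ⟩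
    suc k * N + suc k * (2 * m)  ≤⟨ +-monoʳ-≤ (suc k * N) (*-monoˡ-≤ (2 * m) k<N) ⟩
    suc k * N + N * (2 * m)      ≡⟨ cong (suc k * N +_) (*-comm N (2 * m)) ⟩
    suc k * N + 2 * m * N        ≤⟨ +-monoʳ-≤ (suc k * N) (*-monoˡ-≤ N (m≤m+n (2 * m) 1)) ⟩
    suc k * N + (2 * m + 1) * N  ∎
    where
    open ≤-Reasoning
    c = countS b m N
    reassociate : ∀ d s c → d * s * c ≡ s * (d * c)
    reassociate = solve-∀
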